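{- For every finite nonempty $\Phi\subseteq\mathit{PROP}$ and every set $\mathcal{S}\subseteq\mathcal{M}(\Phi)$ with $\emptyset\in\mathcal{S}$, the set $\mathcal{S}$ is definable in restriction to $\mathcal{M}(\Phi)$ both in $\mathcal{L}_{\mathcal{U}}$ and in $\mathcal{L}_{\mathsf{D}}$; that is, for each of these two logics there is a formula $\varphi$ such that for all $W\in\mathcal{M}(\Phi)$, $W\models\varphi$ iff $W\in\mathcal{S}$.
   Context: Fix a countably infinite set $\mathit{PROP}$ of proposition symbols; assignments are maps $w:\mathit{PROP}\to\{0,1\}$; an SD-model is a (possibly empty) set $W$ of assignments. For $\Phi\subseteq\mathit{PROP}$, $W|_\Phi=\{w|_\Phi:w\in W\}$, and $\mathcal{M}(\Phi)=\{W|_\Phi: W\text{ an SD-model}\}$ is the set of $\Phi$-models (sets of maps $\Phi\to\{0,1\}$); formulae whose proposition symbols lie in $\Phi$ are evaluated on $\Phi$-models by the same clauses as on SD-models. $\mathcal{L}_{\mathcal{U}}$: formulae $\varphi::=p\mid\neg\varphi\mid(\varphi\to\varphi)\mid[\mathsf{U}]\varphi$, with $W,w\models[\mathsf{U}]\varphi$ iff $W,u\models\varphi$ for all $u\in W$. $\mathcal{L}_{\mathsf{D}}$: formulae $\varphi::=p\mid\neg\varphi\mid(\varphi\to\varphi)\mid\mathsf{D}(\varphi_1,\dots,\varphi_k;\psi)$ ($k\in\mathbb{N}$), with $W,w\models\mathsf{D}(\varphi_1,\dots,\varphi_k;\psi)$ iff all $u,v\in W$ agreeing on the truth of each $\varphi_i$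 agree on the truth of $\psi$. In both, $W,w\models p$ iff $w(p)=1$ and $\neg,\to$ are classical; $W\models\varphi$ means $W,w\models\varphi$ for all $w\in W$. -}

module Defs where

open import Data.Nat using (ℕ)
open import Data.Bool using (Bool; true; false)
open import Data.Fin using (Fin)
open import Data.Vec using (Vec; lookup)
open import Data.List using (List; []; _∷_)
open import Data.Product using (Σ; _×_; ∃)
open import Data.Unit using (⊤)
open import Data.Empty using (⊥)
open import Relation.Nullary using (¬_)
open import Relation.Binary.PropositionalEquality using (_≡_)
open import Function.Bundles using (_⇔_)

-- PROP = ℕ (a countably infinite set of proposition symbols).
-- A finite nonempty Φ ⊆ PROP is given by an injective enumeration
-- Φ : Fin m → ℕ  (m = suc n ≥ 1).
-- A Φ-assignment is w : Vec Bool m, where  lookup w i  is the value of symbol Φ i.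
-- A Φ-model is a (decidable, = classical) subset of the finite set of Φ-assignments.
PhiAssignment : ℕ → Set
PhiAssignment m = Vec Bool m

PhiModel : ℕ → Set
PhiModel m = PhiAssignment m → Bool

emptyModel : ∀ {m} → PhiModel m
emptyModel _ = false

-- a set of Φ-models, as a subset of M(Φ); sets are extensional:
ExtensionalFamily : ∀ {m} → (PhiModel m → Bool) → Set
ExtensionalFamily {m} S = ∀ (W W′ : PhiModel m) → (∀ w → W w ≡ W′ w) → S W ≡ S W′

data FormU : Set where
  atom : ℕ → FormU
  ¬U_  : FormU → FormU
  _⇒U_ : FormU → FormU → FormU
  [U]_ : FormU → FormU

module _ {m : ℕ} (Φ : Fin m → ℕ) where

  InΦU : FormU → Set
  InΦU (atom p) = ∃ λ i → Φ i ≡ p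
  InΦU (¬U φ) = InΦU φ
  InΦU (φ ⇒U ψ) = InΦU φ × InΦU ψ
  InΦU ([U] φ) = InΦU φ

  SatU : PhiModel m → PhiAssignment m → FormU → Set
  SatU W w (atom p) = ∃ λ i → Φ i ≡ p × lookup w i ≡ true
  SatU W w (¬U φ) = ¬ SatU W w φ
  SatU W w (φ ⇒U ψ) = SatU W w φ → SatU W w ψ
  SatU W w ([U] φ) = ∀ u → W u ≡ true → SatU W u φ

  ModelsU : PhiModel m → FormU → Set
  ModelsU W φ = ∀ w → W w ≡ true → SatU W w φ

data FormD : Set where
  atom : ℕ → FormD
  ¬D_  : FormD → FormD
  _⇒D_ : FormD → FormD → FormD
  dep  : List FormD → FormD → FormD

module _ {m : ℕ} (Φ : Fin m → ℕ) where

  mutual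
    InΦD : FormD → Set
    InΦD (atom p) = ∃ λ i → Φ i ≡ p
    InΦD (¬D φ) = InΦD φ
    InΦD (φ ⇒D ψ) = InΦD φ × InΦD ψ
    InΦD (dep φs ψ) = InΦDs φs × InΦD ψ

    InΦDs : List FormD → Set
    InΦDs [] = ⊤
    InΦDs (φ ∷ φs) = InΦD φ × InΦDs φs

  mutual
    SatD : PhiModel m → PhiAssignment m → FormD → Set
    SatD W w (atom p) = ∃ λ i → Φ i ≡ p × lookup w i ≡ true
    SatD W w (¬D φ) = ¬ SatD W w φ
    SatD W w (φ ⇒D ψ) = SatD W w φ → SatD W w ψ
    SatD W w (dep φs ψ) =
      ∀ u v → W u ≡ true → W v ≡ true →
        AgreeAll W u v φs → (SatD W u ψ ⇔ SatD W v ψ)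

    AgreeAll : PhiModel m → PhiAssignment m → PhiAssignment m → List FormD → Set
    AgreeAll W u v [] = ⊤
    AgreeAll W u v (φ ∷ φs) = (SatD W u φ ⇔ SatD W v φ) × AgreeAll W u v φs

  ModelsD : PhiModel m → FormD → Set
  ModelsD W φ = ∀ w → W w ≡ true → SatD W w φ

-- Since Φ is finite, a Φ-model W is a finite truth table indexed by the
-- Φ-assignments, and any family S of Φ-models is a Boolean function of that table.
-- Each entry "a ∈ W" is expressed, uniformly at every point of W, by a formula:
-- ¬[U]¬χ_a in L_U and D(;χ_a) → χ_a in L_D, with χ_a the characteristic
-- conjunction of literals of a. Plugging these formulas into a propositional
-- Shannon expansion of S gives a formula true at every point of W iff S W holds;
-- on the empty model both sides hold, since ∅ ∈ S.
module Submission where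

open import Defs
open import Data.Nat using (ℕ; suc; zero)
open import Data.Bool using (Bool; true; false; not; _∧_; _∨_; if_then_else_)
open import Data.Bool.Properties using (not-involutive; ¬-not; ∧-identityʳ)
open import Data.Fin using (Fin; zero)
open import Data.Vec using (Vec; []; _∷_; lookup; map; allFin)
open import Data.Vec.Properties using (∷-injective; map-lookup-allFin)
open import Data.List using ([])
open import Data.Product using (Σ; _×_; _,_; ∃; uncurry)
open import Data.Unit using (tt)
open import Data.Empty using (⊥-elim)
open import Function using (_∘_; id; const)
open import Function.Definitions using (Injective)
open import Function.Bundles using (_⇔_; mk⇔; Equivalence)
open import Function.Construct.Symmetry using (⇔-sym)
open import Relation.Nullary using (¬_)
open import Relation.Nullary.Reflects using (Reflects; ofʸ; ofⁿ; invert; ¬-reflects; _×-reflects_; _→-reflects_)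
open import Relation.Binary.PropositionalEquality using (_≡_; _≢_; _≗_; refl; sym; trans; cong₂; subst; module ≡-Reasoning)

private
  variable
    A B : Set
    V : Set
    b : Bool
    k m : ℕ

false≢true : false ≢ true
false≢true ()

Reflects-⇔ : A ⇔ B → Reflects A b → Reflects B b
Reflects-⇔ A⇔B (ofʸ a) = ofʸ (Equivalence.to A⇔B a)
Reflects-⇔ A⇔B (ofⁿ ¬a) = ofⁿ (¬a ∘ Equivalence.from A⇔B)

co-reflects⇒⇔ : Reflects A b → Reflects B b → A ⇔ B
co-reflects⇒⇔ (ofʸ a) (ofʸ b) = mk⇔ (const b) (const a)
co-reflects⇒⇔ (ofⁿ ¬a) (ofⁿ ¬b) = mk⇔ (⊥-elim ∘ ¬a) (⊥-elim ∘ ¬b)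

infix 6 ¬ᵖ_
infixr 5 _∧ᵖ_
infixr 4 _⇒ᵖ_

data Skeleton (V : Set) : Set where
  var  : V → Skeleton V
  ⊤ᵖ   : Skeleton V
  ¬ᵖ_  : Skeleton V → Skeleton V
  _⇒ᵖ_ : Skeleton V → Skeleton V → Skeleton V

eval : (V → Bool) → Skeleton V → Bool
eval ρ (var v) = ρ v
eval ρ ⊤ᵖ = true
eval ρ (¬ᵖ t) = not (eval ρ t)
eval ρ (t ⇒ᵖ u) = not (eval ρ t) ∨ eval ρ u

_∧ᵖ_ : Skeleton V → Skeleton V → Skeleton V
t ∧ᵖ u = ¬ᵖ (t ⇒ᵖ ¬ᵖ u)

constᵖ : Bool → Skeleton V
constᵖ true = ⊤ᵖ
constᵖ false = ¬ᵖ ⊤ᵖ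

ifᵖ_then_else_ : Skeleton V → Skeleton V → Skeleton V → Skeleton V
ifᵖ c then t else u = (c ⇒ᵖ t) ∧ᵖ (¬ᵖ c ⇒ᵖ u)

literalᵖ : V → Bool → Skeleton V
literalᵖ x true = var x
literalᵖ x false = ¬ᵖ var x

matchᵖ : Vec V k → Vec Bool k → Skeleton V
matchᵖ [] [] = ⊤ᵖ
matchᵖ (x ∷ xs) (b ∷ bs) = literalᵖ x b ∧ᵖ matchᵖ xs bs

module _ (ρ : V → Bool) where

  eval-∧ᵖ : ∀ t u → eval ρ (t ∧ᵖ u) ≡ eval ρ t ∧ eval ρ u
  eval-∧ᵖ t u with eval ρ t
  ... | true = not-involutive (eval ρ u)
  ... | false = refl

  eval-constᵖ : ∀ b → eval ρ (constᵖ b) ≡ b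
  eval-constᵖ true = refl
  eval-constᵖ false = refl

  eval-ifᵖ : ∀ c t u → eval ρ (ifᵖ c then t else u) ≡ (if eval ρ c then eval ρ t else eval ρ u)
  eval-ifᵖ c t u = trans (eval-∧ᵖ (c ⇒ᵖ t) (¬ᵖ c ⇒ᵖ u)) (by-cases (eval ρ c))
    where
    by-cases : ∀ x → (not x ∨ eval ρ t) ∧ (not (not x) ∨ eval ρ u) ≡ (if x then eval ρ t else eval ρ u)
    by-cases true = ∧-identityʳ (eval ρ t)
    by-cases false = refl

  eval-literalᵖ : ∀ x b → Reflects (b ≡ ρ x) (eval ρ (literalᵖ x b))
  eval-literalᵖ x true with ρ x
  ... | true = ofʸ refl
  ... | false = ofⁿ λ ()
  eval-literalᵖ x false with ρ x
  ... | true = ofⁿ λ ()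
  ... | false = ofʸ refl

  eval-matchᵖ : ∀ (xs : Vec V k) bs → Reflects (bs ≡ map ρ xs) (eval ρ (matchᵖ xs bs))
  eval-matchᵖ [] [] = ofʸ refl
  eval-matchᵖ (x ∷ xs) (b ∷ bs) =
    subst (Reflects _) (sym (eval-∧ᵖ (literalᵖ x b) (matchᵖ xs bs)))
      (Reflects-⇔ (mk⇔ (uncurry (cong₂ _∷_)) ∷-injective)
        (eval-literalᵖ x b ×-reflects eval-matchᵖ xs bs))

byHead : (Vec Bool k → A) → (Vec Bool k → A) → Vec Bool (suc k) → A
byHead f₁ f₀ (b ∷ v) = if b then f₁ v else f₀ v

byHead-η : (f : Vec Bool (suc k) → A) → byHead (f ∘ (true ∷_)) (f ∘ (false ∷_)) ≗ f
byHead-η f (true ∷ v) = refl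
byHead-η f (false ∷ v) = refl

byHead-cong : {f₁ g₁ f₀ g₀ : Vec Bool k → A} → f₁ ≗ g₁ → f₀ ≗ g₀ → byHead f₁ f₀ ≗ byHead g₁ g₀
byHead-cong e₁ e₀ (true ∷ v) = e₁ v
byHead-cong e₁ e₀ (false ∷ v) = e₀ v

-- Shannon expansion of a Boolean function of a table f : Vec Bool k → Bool,
-- where the variable x a stands for the entry f a.
expand : ∀ k → (Vec Bool k → V) → ((Vec Bool k → Bool) → Skeleton V) → Skeleton V
expand zero x K = ifᵖ var (x []) then K (const true) else K (const false)
expand (suc k) x K =
  expand k (x ∘ (true ∷_)) λ f₁ → expand k (x ∘ (false ∷_)) λ f₀ → K (byHead f₁ f₀)

EvalRespects : (V → Bool) → ((Vec Bool k → Bool) → Skeleton V) → Set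
EvalRespects ρ K = ∀ f g → f ≗ g → eval ρ (K f) ≡ eval ρ (K g)

eval-expand : ∀ k (ρ : V → Bool) x K → EvalRespects ρ K → eval ρ (expand k x K) ≡ eval ρ (K (ρ ∘ x))
eval-expand zero ρ x K K-resp = trans (eval-ifᵖ ρ (var (x [])) (K (const true)) (K (const false))) branch
  where
  branch : (if ρ (x []) then eval ρ (K (const true)) else eval ρ (K (const false))) ≡ eval ρ (K (ρ ∘ x))
  branch with ρ (x []) in eq
  ... | true = K-resp _ _ λ { [] → sym eq }
  ... | false = K-resp _ _ λ { [] → sym eq }
eval-expand (suc k) ρ x K K-resp = begin
  eval ρ (expand (suc k) x K)
    ≡⟨ eval-expand k ρ (x ∘ (true ∷_)) outer outer-resp ⟩
  eval ρ (outer (ρ ∘ x ∘ (true ∷_)))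
    ≡⟨ eval-expand k ρ (x ∘ (false ∷_)) (inner (ρ ∘ x ∘ (true ∷_))) (inner-resp _) ⟩
  eval ρ (K (byHead (ρ ∘ x ∘ (true ∷_)) (ρ ∘ x ∘ (false ∷_))))
    ≡⟨ K-resp _ _ (byHead-η (ρ ∘ x)) ⟩
  eval ρ (K (ρ ∘ x)) ∎
  where
  open ≡-Reasoning
  inner : (Vec Bool k → Bool) → (Vec Bool k → Bool) → Skeleton _
  inner f₁ f₀ = K (byHead f₁ f₀)
  outer : (Vec Bool k → Bool) → Skeleton _
  outer f₁ = expand k (x ∘ (false ∷_)) (inner f₁)
  inner-resp : ∀ f₁ → EvalRespects ρ (inner f₁)
  inner-resp f₁ f g e = K-resp _ _ (byHead-cong (λ _ → refl) e)
  outer-resp : EvalRespects ρ outer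
  outer-resp f g e = begin
    eval ρ (outer f)                             ≡⟨ eval-expand k ρ _ (inner f) (inner-resp f) ⟩
    eval ρ (K (byHead f (ρ ∘ x ∘ (false ∷_))))   ≡⟨ K-resp _ _ (byHead-cong e (λ _ → refl)) ⟩
    eval ρ (K (byHead g (ρ ∘ x ∘ (false ∷_))))   ≡⟨ eval-expand k ρ _ (inner g) (inner-resp g) ⟨
    eval ρ (outer g)                             ∎

familyᵖ : (PhiModel m → Bool) → Skeleton (PhiAssignment m)
familyᵖ {m} S = expand m id (constᵖ ∘ S)

eval-familyᵖ : (S : PhiModel m → Bool) → ExtensionalFamily S → ∀ W → eval W (familyᵖ S) ≡ S W
eval-familyᵖ {m} S S-ext W = trans
  (eval-expand m W id (constᵖ ∘ S) λ f g e →
    trans (eval-constᵖ W (S f)) (trans (S-ext f g e) (sym (eval-constᵖ W (S g)))))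
  (eval-constᵖ W (S W))

everywhere⇔ : (W : PhiModel m) {P : PhiAssignment m → Set} →
  (∀ w → W w ≡ true → Reflects (P w) b) → ((∀ w → W w ≡ false) → b ≡ true) →
  (∀ w → W w ≡ true → P w) ⇔ (b ≡ true)
everywhere⇔ {b = true} W r _ = mk⇔ (const refl) λ _ w Ww → invert (r w Ww)
everywhere⇔ {b = false} W r empty = mk⇔ (λ all → empty λ w → ¬-not λ Ww → invert (r w Ww) (all w Ww)) λ ()

record ClassicalLogic (m : ℕ) (Φ : Fin m → ℕ) : Set₁ where
  infix 5 ¬′_
  infixr 4 _⇒′_
  field
    Form     : Set
    ¬′_      : Form → Form
    _⇒′_     : Form → Form → Form
    atom′    : ℕ → Form
    InΦ      : Form → Set
    InΦ-¬    : ∀ {φ} → InΦ φ → InΦ (¬′ φ)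
    InΦ-⇒    : ∀ {φ ψ} → InΦ φ → InΦ ψ → InΦ (φ ⇒′ ψ)
    InΦ-atom : ∀ i → InΦ (atom′ (Φ i))
    Sat      : PhiModel m → PhiAssignment m → Form → Set
    sat-¬    : ∀ {W w φ} → Sat W w (¬′ φ) ⇔ (¬ Sat W w φ)
    sat-⇒    : ∀ {W w φ ψ} → Sat W w (φ ⇒′ ψ) ⇔ (Sat W w φ → Sat W w ψ)
    sat-atom : ∀ {W w p} → Sat W w (atom′ p) ⇔ (∃ λ i → Φ i ≡ p × lookup w i ≡ true)

  Models : PhiModel m → Form → Set
  Models W φ = ∀ w → W w ≡ true → Sat W w φ

module ClassicalLogicProperties {n} {Φ : Fin (suc n) → ℕ} (L : ClassicalLogic (suc n) Φ)
  (Φ-injective : Injective _≡_ _≡_ Φ) where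
  open ClassicalLogic L

  ⊤′ : Form
  ⊤′ = atom′ (Φ zero) ⇒′ atom′ (Φ zero)

  embed : (V → Form) → Skeleton V → Form
  embed σ (var v) = σ v
  embed σ ⊤ᵖ = ⊤′
  embed σ (¬ᵖ t) = ¬′ embed σ t
  embed σ (t ⇒ᵖ u) = embed σ t ⇒′ embed σ u

  embed-InΦ : {σ : V → Form} → (∀ v → InΦ (σ v)) → ∀ t → InΦ (embed σ t)
  embed-InΦ InΦ-σ (var v) = InΦ-σ v
  embed-InΦ InΦ-σ ⊤ᵖ = InΦ-⇒ (InΦ-atom zero) (InΦ-atom zero)
  embed-InΦ InΦ-σ (¬ᵖ t) = InΦ-¬ (embed-InΦ InΦ-σ t)
  embed-InΦ InΦ-σ (t ⇒ᵖ u) = InΦ-⇒ (embed-InΦ InΦ-σ t) (embed-InΦ InΦ-σ u)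

  embed-reflects : ∀ {W w} {σ : V → Form} {ρ : V → Bool} →
    (∀ v → Reflects (Sat W w (σ v)) (ρ v)) → ∀ t → Reflects (Sat W w (embed σ t)) (eval ρ t)
  embed-reflects r (var v) = r v
  embed-reflects r ⊤ᵖ = ofʸ (Equivalence.from sat-⇒ id)
  embed-reflects r (¬ᵖ t) = Reflects-⇔ (⇔-sym sat-¬) (¬-reflects (embed-reflects r t))
  embed-reflects r (t ⇒ᵖ u) =
    Reflects-⇔ (⇔-sym sat-⇒) (embed-reflects r t →-reflects embed-reflects r u)

  definable : (S : PhiModel (suc n) → Bool) → ExtensionalFamily S → S emptyModel ≡ true →
    (E : PhiAssignment (suc n) → Form) → (∀ a → InΦ (E a)) →
    (∀ {W w} a → W w ≡ true → Reflects (Sat W w (E a)) (W a)) →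
    Σ Form λ φ → InΦ φ × ((W : PhiModel (suc n)) → Models W φ ⇔ (S W ≡ true))
  definable S S-ext S∅ E InΦ-E E-reflects =
    embed E (familyᵖ S) , embed-InΦ InΦ-E (familyᵖ S) , λ W → everywhere⇔ W
      (λ w Ww → subst (Reflects _) (eval-familyᵖ S S-ext W)
        (embed-reflects (λ a → E-reflects a Ww) (familyᵖ S)))
      (λ W-empty → trans (S-ext W emptyModel W-empty) S∅)

  atom-reflects : ∀ {W w} i → Reflects (Sat W w (atom′ (Φ i))) (lookup w i)
  atom-reflects {w = w} i with lookup w i in eq
  ... | true = ofʸ (Equivalence.from sat-atom (i , refl , eq))
  ... | false = ofⁿ λ s → let (j , Φj≡Φi , wj) = Equivalence.to sat-atom s in
    false≢true (trans (sym eq) (subst (λ l → lookup w l ≡ true) (Φ-injective Φj≡Φi) wj))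

  χ : PhiAssignment (suc n) → Form
  χ a = embed (atom′ ∘ Φ) (matchᵖ (allFin _) a)

  InΦ-χ : ∀ a → InΦ (χ a)
  InΦ-χ a = embed-InΦ InΦ-atom (matchᵖ (allFin _) a)

  sat-χ : ∀ {W w a} → Sat W w (χ a) ⇔ (a ≡ w)
  sat-χ {W} {w} {a} = co-reflects⇒⇔
    (embed-reflects atom-reflects (matchᵖ (allFin _) a))
    (subst (λ v → Reflects (a ≡ v) (eval (lookup w) (matchᵖ (allFin _) a)))
      (map-lookup-allFin w) (eval-matchᵖ (lookup w) (allFin _) a))

  χ-outside : ∀ {W u a} → W a ≡ false → W u ≡ true → ¬ Sat W u (χ a)
  χ-outside {W} {u} {a} Wa Wu s =
    false≢true (trans (sym Wa) (subst (λ v → W v ≡ true) (sym (Equivalence.to (sat-χ {W} {u} {a}) s)) Wu))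

logicU : (Φ : Fin m → ℕ) → ClassicalLogic m Φ
logicU Φ = record
  { Form = FormU ; ¬′_ = ¬U_ ; _⇒′_ = _⇒U_ ; atom′ = atom
  ; InΦ = InΦU Φ ; InΦ-¬ = id ; InΦ-⇒ = _,_ ; InΦ-atom = λ i → i , refl
  ; Sat = SatU Φ ; sat-¬ = mk⇔ id id ; sat-⇒ = mk⇔ id id ; sat-atom = mk⇔ id id
  }

logicD : (Φ : Fin m → ℕ) → ClassicalLogic m Φ
logicD Φ = record
  { Form = FormD ; ¬′_ = ¬D_ ; _⇒′_ = _⇒D_ ; atom′ = atom
  ; InΦ = InΦD Φ ; InΦ-¬ = id ; InΦ-⇒ = _,_ ; InΦ-atom = λ i → i , refl
  ; Sat = SatD Φ ; sat-¬ = mk⇔ id id ; sat-⇒ = mk⇔ id id ; sat-atom = mk⇔ id id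
  }

module Membership {n} (Φ : Fin (suc n) → ℕ) (Φ-injective : Injective _≡_ _≡_ Φ) where

  module U = ClassicalLogicProperties (logicU Φ) Φ-injective
  module D = ClassicalLogicProperties (logicD Φ) Φ-injective

  memberU : PhiAssignment (suc n) → FormU
  memberU a = ¬U [U] ¬U U.χ a

  InΦ-memberU : ∀ a → InΦU Φ (memberU a)
  InΦ-memberU = U.InΦ-χ

  memberU-reflects : ∀ {W w} a → Reflects (SatU Φ W w (memberU a)) (W a)
  memberU-reflects {W} a with W a in Wa
  ... | true = ofʸ λ nowhere → nowhere a Wa (Equivalence.from U.sat-χ refl)
  ... | false = ofⁿ λ somewhere → somewhere λ u Wu → U.χ-outside Wa Wu

  -- D(; χ a) says that χ a is constant on W, which fails exactly when W has a point other than a.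
  memberD : PhiAssignment (suc n) → FormD
  memberD a = dep [] (D.χ a) ⇒D D.χ a

  InΦ-memberD : ∀ a → InΦD Φ (memberD a)
  InΦ-memberD a = (tt , D.InΦ-χ a) , D.InΦ-χ a

  memberD-reflects : ∀ {W w} a → W w ≡ true → Reflects (SatD Φ W w (memberD a)) (W a)
  memberD-reflects {W} {w} a Ww with W a in Wa
  ... | true = ofʸ λ χa-constant → Equivalence.to (χa-constant a w Wa Ww tt) (Equivalence.from D.sat-χ refl)
  ... | false = ofⁿ λ implies → D.χ-outside Wa Ww (implies λ u v Wu Wv _ →
        mk⇔ (⊥-elim ∘ D.χ-outside Wa Wu) (⊥-elim ∘ D.χ-outside Wa Wv))

proposition3p9 : (n : ℕ) (Φ : Fin (suc n) → ℕ) → Injective _≡_ _≡_ Φ →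
    (S : PhiModel (suc n) → Bool) → ExtensionalFamily S → S emptyModel ≡ true →
    (Σ FormU (λ φ → InΦU Φ φ × ((W : PhiModel (suc n)) → (ModelsU Φ W φ ⇔ (S W ≡ true)))))
    × (Σ FormD (λ φ → InΦD Φ φ × ((W : PhiModel (suc n)) → (ModelsD Φ W φ ⇔ (S W ≡ true)))))
proposition3p9 n Φ Φ-injective S S-ext S∅ =
    U.definable S S-ext S∅ memberU InΦ-memberU (λ {_} {w} a _ → memberU-reflects {w = w} a)
  , D.definable S S-ext S∅ memberD InΦ-memberD memberD-reflects
  where open Membership Φ Φ-injective
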